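{- Let $\lambda$ be a partition and evaluate the word $M(\lambda)$ as a product of $3\times 3$ integer matrices by substituting \[ X=\begin{bmatrix}1&0&0\\0&1&-1\\0&0&-1\end{bmatrix},\qquad Y=\begin{bmatrix}1&1&0\\0&1&0\\0&0&1\end{bmatrix}. \] Then \[ M(\lambda)=\begin{bmatrix}1&\lambda_1&-a(\lambda)\\0&1&-\overline{\ell(\lambda)}\\0&0&(-1)^{\ell(\lambda)}\end{bmatrix}, \] where $a(\lambda)=\sum_{k=1}^{\ell(\lambda)}(-1)^{k-1}\lambda_k=\lambda_1-\lambda_2+\lambda_3-\cdots$ and $\overline{\ell(\lambda)}\in\{0,1\}$ equals $1$ if $\ell(\lambda)$ is odd and $0$ if $\ell(\lambda)$ is even.
   Context: A partition $\lambda=(\lambda_1,\dots,\lambda_\ell)$ is a finite weakly decreasing sequence of positive integers; $\ell(\lambda)=\ell$ is its length, and for the empty partition $\lambda_1:=0$. The $(i,j)$-hook length $h_{i,j}(\lambda)$ is the number of cells $(a,b)$ of the Young diagram $\{(a,b):1\le a\le\ell,\ 1\le b\le\lambda_a\}$ with ($a=i$, $b\ge j$) or ($a\ge i$, $b=j$). The partition sequence $M(\lambda)$ is the word in letters $X,Y$ of length $h_{1,1}(\lambda)+1$ whose $t$-th letter is $X$ if $t=h_{k,1}(\lambda)+1$ for some $k$ and $Y$ otherwise; $M(())$ is the empty word. Equivalently $M(\lambda)=Y^{\lambda_\ell}XY^{\lambda_{\ell-1}-\lambda_\ell}X\cdots Y^{\lambda_1-\lambda_2}X$. A word $w_1\cdots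 w_m$ is evaluated as the matrix product $W_1\cdots W_m$ in this order, where $W_t$ is the matrix substituted for $w_t$; the empty word gives the identity matrix. -}

module Defs where

open import Data.Nat using (ℕ; zero; suc; _+_; _∸_; _≤_; _<_; _≡ᵇ_; _≤ᵇ_)
open import Data.Bool using (Bool; true; false; if_then_else_; _∧_)
open import Data.List using (List; []; _∷_; length; map; upTo)
open import Data.Bool.ListAction using (any)
open import Data.Fin using (Fin; zero; suc)
open import Data.Integer using (ℤ; +_; -_) renaming (_+_ to _+ℤ_; _*_ to _*ℤ_; _-_ to _-ℤ_)
open import Data.Product using (_×_)

data Decreasing : List ℕ → Set where
  dec-nil  : Decreasing []
  dec-one  : ∀ {x} → Decreasing (x ∷ [])
  dec-cons : ∀ {x y xs} → y ≤ x → Decreasing (y ∷ xs) → Decreasing (x ∷ y ∷ xs)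

data AllPos : List ℕ → Set where
  pos-nil  : AllPos []
  pos-cons : ∀ {x xs} → 0 < x → AllPos xs → AllPos (x ∷ xs)

IsPartition : List ℕ → Set
IsPartition λs = Decreasing λs × AllPos λs

len : List ℕ → ℕ
len = length

-- λ_i (1-indexed); 0 outside the range (so λ_1 = 0 for the empty partition)
part : List ℕ → ℕ → ℕ
part []       _             = 0
part (x ∷ xs) zero          = 0
part (x ∷ xs) (suc zero)    = x
part (x ∷ xs) (suc (suc i)) = part xs (suc i)

countRows : List ℕ → ℕ → ℕ → ℕ
countRows λs i j = go (upTo (len λs))
  where
  go : List ℕ → ℕ
  go [] = 0
  go (a₀ ∷ as) =
    (if (i ≤ᵇ suc a₀) ∧ (j ≤ᵇ part λs (suc a₀)) then 1 else 0) + go as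

-- hook length h_{i,j}(λ) for a cell (i,j) of the diagram:
-- cells (i,b) with b ≥ j : λ_i - j + 1 of them;
-- cells (a,j) with a > i : (#{a ≥ i : λ_a ≥ j}) - 1 of them.
-- total = (λ_i ∸ j) + #{a ≥ i : λ_a ≥ j}
hook : List ℕ → ℕ → ℕ → ℕ
hook λs i j = (part λs i ∸ j) + countRows λs i j

data Letter : Set where
  X Y : Letter

isXPos : List ℕ → ℕ → Bool
isXPos λs t = any (λ k₀ → t ≡ᵇ suc (hook λs (suc k₀) 1)) (upTo (len λs))

M : List ℕ → List Letter
M []         = []
M λs@(_ ∷ _) = map (λ t₀ → if isXPos λs (suc t₀) then X else Y)
                   (upTo (suc (hook λs 1 1)))

Mat3 : Set
Mat3 = Fin 3 → Fin 3 → ℤ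

_⊗_ : Mat3 → Mat3 → Mat3
(A ⊗ B) i j = A i zero *ℤ B zero j +ℤ (A i (suc zero) *ℤ B (suc zero) j
              +ℤ A i (suc (suc zero)) *ℤ B (suc (suc zero)) j)

mat : ℤ → ℤ → ℤ → ℤ → ℤ → ℤ → ℤ → ℤ → ℤ → Mat3
mat a b c d e f g h k zero zero = a
mat a b c d e f g h k zero (suc zero) = b
mat a b c d e f g h k zero (suc (suc zero)) = c
mat a b c d e f g h k (suc zero) zero = d
mat a b c d e f g h k (suc zero) (suc zero) = e
mat a b c d e f g h k (suc zero) (suc (suc zero)) = f
mat a b c d e f g h k (suc (suc zero)) zero = g
mat a b c d e f g h k (suc (suc zero)) (suc zero) = h
mat a b c d e f g h k (suc (suc zero)) (suc (suc zero)) = k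

I3 : Mat3
I3 = mat (+ 1) (+ 0) (+ 0) (+ 0) (+ 1) (+ 0) (+ 0) (+ 0) (+ 1)

Xm : Mat3
Xm = mat (+ 1) (+ 0) (+ 0) (+ 0) (+ 1) (- (+ 1)) (+ 0) (+ 0) (- (+ 1))

Ym : Mat3
Ym = mat (+ 1) (+ 1) (+ 0) (+ 0) (+ 1) (+ 0) (+ 0) (+ 0) (+ 1)

letterMat : Letter → Mat3
letterMat X = Xm
letterMat Y = Ym

evalWord : List Letter → Mat3
evalWord []       = I3
evalWord (w ∷ ws) = letterMat w ⊗ evalWord ws

negOnePow : ℕ → ℤ
negOnePow zero    = + 1
negOnePow (suc n) = - negOnePow n

altSum : List ℕ → ℤ
altSum λs = go (upTo (len λs))
  where
  go : List ℕ → ℤ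
  go [] = + 0
  go (k₀ ∷ ks) = negOnePow k₀ *ℤ (+ part λs (suc k₀)) +ℤ go ks

parityBar : ℕ → ℕ
parityBar zero          = 0
parityBar (suc zero)    = 1
parityBar (suc (suc n)) = parityBar n

-- With all parts positive, h_{k,1}(λ) = λ_k + ℓ − k, so the X's of M(x ∷ λ′) are those of
-- M(λ′) plus one at the new last position x + ℓ, i.e. M(x ∷ λ′) = M(λ′) Y^(x − λ′₁) X.
-- Every matrix met has the shape [[1,p,−a],[0,1,−b],[0,0,s]], and right multiplication by
-- Y^d X sends (p, a, b, s) to (p + d, p + d − a, 1 − b, −s): exactly how λ₁, a(λ), the parity
-- of ℓ and (−1)^ℓ change when a new largest part is put in front of a partition.
module Submission where

open import Defs
open import Data.Bool using (true; false; if_then_else_; _∧_; _∨_)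
open import Data.Bool.ListAction using (any; or)
open import Data.Bool.Properties using (¬-not; T-≡)
open import Data.Fin using (Fin; zero; suc)
open import Data.Integer using (ℤ; +_; -_) renaming (_+_ to _+ℤ_; _*_ to _*ℤ_; _-_ to _-ℤ_)
import Data.Integer.Properties as ℤ
open import Data.Integer.Tactic.RingSolver using (solve; solve-∀)
open import Data.List using (List; []; _∷_; _++_; _∷ʳ_; foldr; map; replicate; applyUpTo; upTo)
open import Data.List.Properties
  using (foldr-universal; foldr-cong; foldr-fusion; foldr-map; map-∘; map-cong; map-upTo; applyUpTo-∷ʳ)
open import Data.Nat using (ℕ; zero; suc; _+_; _∸_; _≤_; _<_; _≡ᵇ_; _≤ᵇ_; z≤n; s≤s; z<s; s<s)
open import Data.Nat.Properties
  using (≡ᵇ⇒≡; <⇒≢; >⇒≢; ≤-<-trans; <-trans; m≤m+n; m<m+n; +-monoʳ-<; +-mono-≤-<; n<1+n; +-suc; m+[n∸m]≡n)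
import Data.Nat.Tactic.RingSolver as ℕ-Solver
open import Data.Product using (_,_; proj₂)
open import Function using (_∘_; Equivalence)
open import Level using (0ℓ)
open import Relation.Binary.Bundles using (Setoid)
open import Relation.Binary.PropositionalEquality
import Relation.Binary.Reasoning.Setoid as SetoidReasoning

private
  variable
    x : ℕ
    xs λs : List ℕ

upTo-suc : ∀ n → upTo (suc n) ≡ 0 ∷ map suc (upTo n)
upTo-suc n = cong (0 ∷_) (sym (map-upTo suc n))

applyUpTo-+ : {A : Set} (f : ℕ → A) (m n : ℕ) →
              applyUpTo f (m + n) ≡ applyUpTo f m ++ applyUpTo (λ k → f (m + k)) n
applyUpTo-+ f zero    n = refl
applyUpTo-+ f (suc m) n = cong (f 0 ∷_) (applyUpTo-+ (f ∘ suc) m n)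

applyUpTo-cong : {A : Set} {f g : ℕ → A} (n : ℕ) →
                 (∀ {k} → k < n → f k ≡ g k) → applyUpTo f n ≡ applyUpTo g n
applyUpTo-cong zero    f≡g = refl
applyUpTo-cong (suc n) f≡g = cong₂ _∷_ (f≡g z<s) (applyUpTo-cong n (f≡g ∘ s<s))

applyUpTo-replicate : {A : Set} {f : ℕ → A} {a : A} (n : ℕ) →
                      (∀ {k} → k < n → f k ≡ a) → applyUpTo f n ≡ replicate n a
applyUpTo-replicate zero    f≡a = refl
applyUpTo-replicate (suc n) f≡a = cong₂ _∷_ (f≡a z<s) (applyUpTo-replicate n (f≡a ∘ s<s))

≡ᵇ-refl : ∀ n → (n ≡ᵇ n) ≡ true
≡ᵇ-refl zero    = refl
≡ᵇ-refl (suc n) = ≡ᵇ-refl n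

≢⇒≡ᵇ-false : ∀ {m n} → m ≢ n → (m ≡ᵇ n) ≡ false
≢⇒≡ᵇ-false {m} {n} m≢n = ¬-not (m≢n ∘ ≡ᵇ⇒≡ m n ∘ Equivalence.from T-≡)

IsPartition-tail : IsPartition (x ∷ xs) → IsPartition xs
IsPartition-tail (dec-one      , pos-cons _ ps) = dec-nil , ps
IsPartition-tail (dec-cons _ d , pos-cons _ ps) = d , ps

IsPartition-λ₂≤λ₁ : IsPartition (x ∷ xs) → part xs 1 ≤ x
IsPartition-λ₂≤λ₁ (dec-one        , _) = z≤n
IsPartition-λ₂≤λ₁ (dec-cons y≤x _ , _) = y≤x

rowIndicator : List ℕ → ℕ → ℕ → ℕ → ℕ
rowIndicator λs i j a = if (i ≤ᵇ suc a) ∧ (j ≤ᵇ part λs (suc a)) then 1 else 0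

-- `countRows` and `altSum` recurse over `upTo ℓ` through unnameable `where`-functions.
-- Abstracting that list together with `foldr-universal` lets Agda solve the `h` of
-- `foldr-universal` as the hidden function, identifying it with a `foldr`.
countRows≡foldr : ∀ λs i j →
  countRows λs i j ≡ foldr (λ a r → rowIndicator λs i j a + r) 0 (upTo (len λs))
countRows≡foldr λs i j
  with upTo (len λs) | foldr-universal {B = ℕ} _ (λ a r → rowIndicator λs i j a + r) 0
... | as | universal = universal refl (λ _ _ → refl) as

altSum≡foldr : ∀ λs →
  altSum λs ≡ foldr (λ k r → negOnePow k *ℤ + part λs (suc k) +ℤ r) (+ 0) (upTo (len λs))
altSum≡foldr λs
  with upTo (len λs) | foldr-universal {B = ℤ} _ (λ k r → negOnePow k *ℤ + part λs (suc k) +ℤ r) (+ 0)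
... | ks | universal = universal refl (λ _ _ → refl) ks

rowIndicator-suc : ∀ x xs i j a → rowIndicator (x ∷ xs) (suc i) j (suc a) ≡ rowIndicator xs i j a
rowIndicator-suc x xs zero    j a = refl
rowIndicator-suc x xs (suc i) j a = refl

countRows-cons : ∀ x xs i j →
  countRows (x ∷ xs) (suc i) j ≡ rowIndicator (x ∷ xs) (suc i) j 0 + countRows xs i j
countRows-cons x xs i j = begin
  countRows (x ∷ xs) (suc i) j
    ≡⟨ countRows≡foldr (x ∷ xs) (suc i) j ⟩
  foldr F 0 (upTo (suc n))
    ≡⟨ cong (foldr F 0) (upTo-suc n) ⟩
  F 0 (foldr F 0 (map suc (upTo n)))
    ≡⟨ cong (F 0) (foldr-map F suc 0 (upTo n)) ⟩
  F 0 (foldr (λ a → F (suc a)) 0 (upTo n))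
    ≡⟨ cong (F 0) (foldr-cong shift refl (upTo n)) ⟩
  F 0 (foldr (λ a r → rowIndicator xs i j a + r) 0 (upTo n))
    ≡⟨ cong (F 0) (sym (countRows≡foldr xs i j)) ⟩
  rowIndicator (x ∷ xs) (suc i) j 0 + countRows xs i j ∎
  where
  open ≡-Reasoning
  n = len xs
  F = λ a r → rowIndicator (x ∷ xs) (suc i) j a + r
  shift : ∀ a r → F (suc a) r ≡ rowIndicator xs i j a + r
  shift a r = cong (_+ r) (rowIndicator-suc x xs i j a)

countRows-zero : ∀ λs j → countRows λs 0 j ≡ countRows λs 1 j
countRows-zero λs j = trans (countRows≡foldr λs 0 j) (sym (countRows≡foldr λs 1 j))

countRows-1-1 : AllPos λs → countRows λs 1 1 ≡ len λs
countRows-1-1 {[]}     pos-nil = refl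
countRows-1-1 {x ∷ xs} (pos-cons (s≤s _) ps) =
  trans (countRows-cons x xs 0 1) (cong suc (trans (countRows-zero xs 1) (countRows-1-1 ps)))

hook-1-1 : AllPos (x ∷ xs) → suc (hook (x ∷ xs) 1 1) ≡ x + suc (len xs)
hook-1-1 {suc x} ps@(pos-cons (s≤s _) _) = cong (λ c → suc (x + c)) (countRows-1-1 ps)

hook-cons : ∀ x xs k j → hook (x ∷ xs) (suc (suc k)) j ≡ hook xs (suc k) j
hook-cons x xs k j = cong (λ c → part xs (suc k) ∸ j + c) (countRows-cons x xs (suc k) j)

altSum-cons : ∀ x xs → altSum (x ∷ xs) ≡ + x -ℤ altSum xs
altSum-cons x xs = begin
  altSum (x ∷ xs)
    ≡⟨ altSum≡foldr (x ∷ xs) ⟩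
  foldr F (+ 0) (upTo (suc n))
    ≡⟨ cong (foldr F (+ 0)) (upTo-suc n) ⟩
  F 0 (foldr F (+ 0) (map suc (upTo n)))
    ≡⟨ cong (F 0) (foldr-map F suc (+ 0) (upTo n)) ⟩
  F 0 (foldr (λ k → F (suc k)) (+ 0) (upTo n))
    ≡⟨ cong (F 0) (sym (foldr-fusion -_ (+ 0) negate (upTo n))) ⟩
  F 0 (- foldr G (+ 0) (upTo n))
    ≡⟨ cong (λ a → F 0 (- a)) (sym (altSum≡foldr xs)) ⟩
  + 1 *ℤ + x -ℤ altSum xs
    ≡⟨ cong (_-ℤ altSum xs) (ℤ.*-identityˡ (+ x)) ⟩
  + x -ℤ altSum xs ∎
  where
  open ≡-Reasoning
  n = len xs
  F = λ k r → negOnePow k *ℤ + part (x ∷ xs) (suc k) +ℤ r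
  G = λ k r → negOnePow k *ℤ + part xs (suc k) +ℤ r
  negate : ∀ k r → - G k r ≡ F (suc k) (- r)
  negate k r = trans (ℤ.neg-distrib-+ (negOnePow k *ℤ + part xs (suc k)) r)
                     (cong (_+ℤ - r) (ℤ.neg-distribˡ-* (negOnePow k) (+ part xs (suc k))))

isXPos-cons : ∀ t → AllPos (x ∷ xs) →
  isXPos (x ∷ xs) t ≡ (t ≡ᵇ x + suc (len xs)) ∨ isXPos xs t
isXPos-cons {x} {xs} t ps = begin
  isXPos (x ∷ xs) t
    ≡⟨ cong (any p) (upTo-suc n) ⟩
  p 0 ∨ or (map p (map suc (upTo n)))
    ≡⟨ cong (λ h → (t ≡ᵇ h) ∨ or (map p (map suc (upTo n)))) (hook-1-1 ps) ⟩
  (t ≡ᵇ x + suc n) ∨ or (map p (map suc (upTo n)))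
    ≡⟨ cong (λ bs → (t ≡ᵇ x + suc n) ∨ or bs) (sym (map-∘ (upTo n))) ⟩
  (t ≡ᵇ x + suc n) ∨ or (map (p ∘ suc) (upTo n))
    ≡⟨ cong (λ bs → (t ≡ᵇ x + suc n) ∨ or bs)
            (map-cong (λ k → cong (λ h → t ≡ᵇ suc h) (hook-cons x xs k 1)) (upTo n)) ⟩
  (t ≡ᵇ x + suc n) ∨ isXPos xs t ∎
  where
  open ≡-Reasoning
  n = len xs
  p = λ k → t ≡ᵇ suc (hook (x ∷ xs) (suc k) 1)

isXPos-cons-≢ : ∀ {t} → AllPos (x ∷ xs) → t ≢ x + suc (len xs) → isXPos (x ∷ xs) t ≡ isXPos xs t
isXPos-cons-≢ {xs = xs} {t} ps t≢ =
  trans (isXPos-cons t ps) (cong (_∨ isXPos xs t) (≢⇒≡ᵇ-false t≢))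

isXPos-cons-≡ : ∀ {t} → AllPos (x ∷ xs) → t ≡ x + suc (len xs) → isXPos (x ∷ xs) t ≡ true
isXPos-cons-≡ {xs = xs} {t} ps refl = trans (isXPos-cons t ps) (cong (_∨ isXPos xs t) (≡ᵇ-refl t))

isXPos-beyond : ∀ {t} → IsPartition λs → part λs 1 + len λs < t → isXPos λs t ≡ false
isXPos-beyond {[]}     _ _ = refl
isXPos-beyond {x ∷ xs} P@(_ , ps) t> =
  trans (isXPos-cons-≢ ps (>⇒≢ t>))
        (isXPos-beyond (IsPartition-tail P) (<-trans (+-mono-≤-< (IsPartition-λ₂≤λ₁ P) (n<1+n _)) t>))

letterAt : List ℕ → ℕ → Letter
letterAt λs t₀ = if isXPos λs (suc t₀) then X else Y

M≡applyUpTo : AllPos λs → M λs ≡ applyUpTo (letterAt λs) (part λs 1 + len λs)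
M≡applyUpTo {[]}     _  = refl
M≡applyUpTo {x ∷ xs} ps =
  trans (cong (map (letterAt (x ∷ xs)) ∘ upTo) (hook-1-1 ps)) (map-upTo (letterAt (x ∷ xs)) _)

M-cons : IsPartition (x ∷ xs) → M (x ∷ xs) ≡ M xs ++ replicate (x ∸ part xs 1) Y ++ X ∷ []
M-cons {x} {xs} P@(_ , ps) = begin
  M (x ∷ xs)
    ≡⟨ M≡applyUpTo ps ⟩
  applyUpTo L (x + suc n)
    ≡⟨ cong (applyUpTo L) split ⟩
  applyUpTo L (N + suc d)
    ≡⟨ applyUpTo-+ L N (suc d) ⟩
  applyUpTo L N ++ applyUpTo (λ e → L (N + e)) (suc d)
    ≡⟨ cong₂ _++_ (trans (applyUpTo-cong N before) (sym (M≡applyUpTo (proj₂ P′))))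
                  (trans (sym (applyUpTo-∷ʳ _ d)) (cong₂ _∷ʳ_ (applyUpTo-replicate d gap) last)) ⟩
  M xs ++ replicate d Y ++ X ∷ [] ∎
  where
  open ≡-Reasoning
  P′ = IsPartition-tail P
  n = len xs
  λ₂ = part xs 1
  N = λ₂ + n
  d = x ∸ λ₂
  L = letterAt (x ∷ xs)
  split : x + suc n ≡ N + suc d
  split = trans (cong (_+ suc n) (sym (m+[n∸m]≡n (IsPartition-λ₂≤λ₁ P)))) (shuffle λ₂ d n)
    where
    shuffle : ∀ a b c → a + b + suc c ≡ a + c + suc b
    shuffle = ℕ-Solver.solve-∀
  below : ∀ {t} → t < N + suc d → isXPos (x ∷ xs) t ≡ isXPos xs t
  below {t} t< = isXPos-cons-≢ ps (<⇒≢ (subst (t <_) (sym split) t<))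
  before : ∀ {t₀} → t₀ < N → L t₀ ≡ letterAt xs t₀
  before t₀<N = cong (if_then X else Y) (below (≤-<-trans t₀<N (m<m+n N z<s)))
  gap : ∀ {e} → e < d → L (N + e) ≡ Y
  gap {e} e<d = cong (if_then X else Y) (trans
    (below (subst (suc (N + e) <_) (sym (+-suc N d)) (s<s (+-monoʳ-< N e<d))))
    (isXPos-beyond P′ (s<s (m≤m+n N e))))
  last : L (N + d) ≡ X
  last = cong (if_then X else Y) (isXPos-cons-≡ ps (trans (sym (+-suc N d)) (sym split)))

infix 4 _≈_

_≈_ : Mat3 → Mat3 → Set
A ≈ B = ∀ i j → A i j ≡ B i j

≈-setoid : Setoid 0ℓ 0ℓ
≈-setoid = record
  { Carrier       = Mat3
  ; _≈_           = _≈_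
  ; isEquivalence = record
    { refl  = λ _ _ → refl
    ; sym   = λ A≈B i j → sym (A≈B i j)
    ; trans = λ A≈B B≈C i j → trans (A≈B i j) (B≈C i j)
    }
  }

module ≈-Reasoning = SetoidReasoning ≈-setoid

pattern one = suc zero
pattern two = suc (suc zero)

⊗-cong : ∀ {A A′ B B′} → A ≈ A′ → B ≈ B′ → A ⊗ B ≈ A′ ⊗ B′
⊗-cong A≈ B≈ i j =
  cong₂ _+ℤ_ (cong₂ _*ℤ_ (A≈ i zero) (B≈ zero j))
    (cong₂ _+ℤ_ (cong₂ _*ℤ_ (A≈ i one) (B≈ one j)) (cong₂ _*ℤ_ (A≈ i two) (B≈ two j)))

⊗-congˡ : ∀ A {B B′} → B ≈ B′ → A ⊗ B ≈ A ⊗ B′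
⊗-congˡ A = ⊗-cong {A} (λ _ _ → refl)

⊗-assoc : ∀ A B C → A ⊗ (B ⊗ C) ≈ (A ⊗ B) ⊗ C
⊗-assoc A B C i j =
  assoc (A i zero) (A i one) (A i two)
        (B zero zero) (B zero one) (B zero two)
        (B one zero)  (B one one)  (B one two)
        (B two zero)  (B two one)  (B two two)
        (C zero j) (C one j) (C two j)
  where
  assoc : ∀ a₀ a₁ a₂ b₀₀ b₀₁ b₀₂ b₁₀ b₁₁ b₁₂ b₂₀ b₂₁ b₂₂ c₀ c₁ c₂ →
    a₀ *ℤ (b₀₀ *ℤ c₀ +ℤ (b₀₁ *ℤ c₁ +ℤ b₀₂ *ℤ c₂))
      +ℤ (a₁ *ℤ (b₁₀ *ℤ c₀ +ℤ (b₁₁ *ℤ c₁ +ℤ b₁₂ *ℤ c₂))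
             +ℤ a₂ *ℤ (b₂₀ *ℤ c₀ +ℤ (b₂₁ *ℤ c₁ +ℤ b₂₂ *ℤ c₂)))
    ≡ (a₀ *ℤ b₀₀ +ℤ (a₁ *ℤ b₁₀ +ℤ a₂ *ℤ b₂₀)) *ℤ c₀
      +ℤ ((a₀ *ℤ b₀₁ +ℤ (a₁ *ℤ b₁₁ +ℤ a₂ *ℤ b₂₁)) *ℤ c₁
             +ℤ (a₀ *ℤ b₀₂ +ℤ (a₁ *ℤ b₁₂ +ℤ a₂ *ℤ b₂₂)) *ℤ c₂)
  assoc = solve-∀

⊗-identityˡ : ∀ A → I3 ⊗ A ≈ A
⊗-identityˡ A zero j = trans (ℤ.+-identityʳ _) (ℤ.*-identityˡ _)
⊗-identityˡ A one  j = trans (ℤ.+-identityˡ _) (trans (ℤ.+-identityʳ _) (ℤ.*-identityˡ _))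
⊗-identityˡ A two  j = trans (ℤ.+-identityˡ _) (trans (ℤ.+-identityˡ _) (ℤ.*-identityˡ _))

evalWord-++ : ∀ u v → evalWord (u ++ v) ≈ evalWord u ⊗ evalWord v
evalWord-++ []      v = λ i j → sym (⊗-identityˡ (evalWord v) i j)
evalWord-++ (w ∷ u) v = begin
  letterMat w ⊗ evalWord (u ++ v)            ≈⟨ ⊗-congˡ (letterMat w) (evalWord-++ u v) ⟩
  letterMat w ⊗ (evalWord u ⊗ evalWord v)    ≈⟨ ⊗-assoc (letterMat w) (evalWord u) (evalWord v) ⟩
  (letterMat w ⊗ evalWord u) ⊗ evalWord v    ∎
  where open ≈-Reasoning

triMat : ℤ → ℤ → ℤ → ℤ → Mat3
triMat p a b s = mat (+ 1) p (- a) (+ 0) (+ 1) (- b) (+ 0) (+ 0) s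

triMat-cong : ∀ {p p′ a a′ b b′ s s′} →
  p ≡ p′ → a ≡ a′ → b ≡ b′ → s ≡ s′ → triMat p a b s ≈ triMat p′ a′ b′ s′
triMat-cong refl refl refl refl _ _ = refl

triMat-⊗ : ∀ p a b s p′ a′ b′ s′ →
  triMat p a b s ⊗ triMat p′ a′ b′ s′
    ≈ triMat (p +ℤ p′) (a′ +ℤ p *ℤ b′ +ℤ a *ℤ s′) (b′ +ℤ b *ℤ s′) (s *ℤ s′)
triMat-⊗ p a b s p′ a′ b′ s′ = λ where
    zero zero → e₀₀; zero one → e₀₁; zero two → e₀₂
    one  zero → e₁₀; one  one → e₁₁; one  two → e₁₂
    two  zero → e₂₀; two  one → e₂₁; two  two → e₂₂
  where
  e₀₀ : + 1 *ℤ + 1 +ℤ (p *ℤ + 0 +ℤ - a *ℤ + 0) ≡ + 1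
  e₀₀ = solve (p ∷ a ∷ [])
  e₀₁ : + 1 *ℤ p′ +ℤ (p *ℤ + 1 +ℤ - a *ℤ + 0) ≡ p +ℤ p′
  e₀₁ = solve (p ∷ a ∷ p′ ∷ [])
  e₀₂ : + 1 *ℤ - a′ +ℤ (p *ℤ - b′ +ℤ - a *ℤ s′) ≡ - (a′ +ℤ p *ℤ b′ +ℤ a *ℤ s′)
  e₀₂ = solve (p ∷ a ∷ a′ ∷ b′ ∷ s′ ∷ [])
  e₁₀ : + 0 *ℤ + 1 +ℤ (+ 1 *ℤ + 0 +ℤ - b *ℤ + 0) ≡ + 0
  e₁₀ = solve (b ∷ [])
  e₁₁ : + 0 *ℤ p′ +ℤ (+ 1 *ℤ + 1 +ℤ - b *ℤ + 0) ≡ + 1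
  e₁₁ = solve (b ∷ p′ ∷ [])
  e₁₂ : + 0 *ℤ - a′ +ℤ (+ 1 *ℤ - b′ +ℤ - b *ℤ s′) ≡ - (b′ +ℤ b *ℤ s′)
  e₁₂ = solve (b ∷ a′ ∷ b′ ∷ s′ ∷ [])
  e₂₀ : + 0 *ℤ + 1 +ℤ (+ 0 *ℤ + 0 +ℤ s *ℤ + 0) ≡ + 0
  e₂₀ = solve (s ∷ [])
  e₂₁ : + 0 *ℤ p′ +ℤ (+ 0 *ℤ + 1 +ℤ s *ℤ + 0) ≡ + 0
  e₂₁ = solve (s ∷ p′ ∷ [])
  e₂₂ : + 0 *ℤ - a′ +ℤ (+ 0 *ℤ - b′ +ℤ s *ℤ s′) ≡ s *ℤ s′
  e₂₂ = solve (s ∷ a′ ∷ b′ ∷ s′ ∷ [])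

evalWord-replicate-Y : ∀ d → evalWord (replicate d Y) ≈ triMat (+ d) (+ 0) (+ 0) (+ 1)
evalWord-replicate-Y zero    = λ _ _ → refl
evalWord-replicate-Y (suc d) = begin
  Ym ⊗ evalWord (replicate d Y)
    ≈⟨ ⊗-congˡ Ym (evalWord-replicate-Y d) ⟩
  triMat (+ 1) (+ 0) (+ 0) (+ 1) ⊗ triMat (+ d) (+ 0) (+ 0) (+ 1)
    ≈⟨ triMat-⊗ (+ 1) (+ 0) (+ 0) (+ 1) (+ d) (+ 0) (+ 0) (+ 1) ⟩
  triMat (+ suc d) (+ 0) (+ 0) (+ 1) ∎
  where open ≈-Reasoning

evalWord-Yᵈ-X : ∀ d → evalWord (replicate d Y ++ X ∷ []) ≈ triMat (+ d) (+ d) (+ 1) (- + 1)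
evalWord-Yᵈ-X d = begin
  evalWord (replicate d Y ++ X ∷ [])
    ≈⟨ evalWord-++ (replicate d Y) (X ∷ []) ⟩
  evalWord (replicate d Y) ⊗ (Xm ⊗ I3)
    ≈⟨ ⊗-cong (evalWord-replicate-Y d) (triMat-⊗ (+ 0) (+ 0) (+ 1) (- + 1) (+ 0) (+ 0) (+ 0) (+ 1)) ⟩
  triMat D (+ 0) (+ 0) (+ 1) ⊗ triMat (+ 0) (+ 0) (+ 1) (- + 1)
    ≈⟨ triMat-⊗ D (+ 0) (+ 0) (+ 1) (+ 0) (+ 0) (+ 1) (- + 1) ⟩
  triMat (D +ℤ + 0) (+ 0 +ℤ D *ℤ + 1 +ℤ + 0 *ℤ - + 1) (+ 1) (- + 1)
    ≈⟨ triMat-cong (ℤ.+-identityʳ D)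
                   (trans (ℤ.+-identityʳ _) (trans (ℤ.+-identityˡ _) (ℤ.*-identityʳ D))) refl refl ⟩
  triMat D D (+ 1) (- + 1) ∎
  where
  open ≈-Reasoning
  D = + d

triMat-⊗-Yᵈ-X : ∀ p a b s d →
  triMat p a b s ⊗ triMat d d (+ 1) (- + 1) ≈ triMat (p +ℤ d) ((p +ℤ d) -ℤ a) (+ 1 -ℤ b) (- s)
triMat-⊗-Yᵈ-X p a b s d = begin
  triMat p a b s ⊗ triMat d d (+ 1) (- + 1)
    ≈⟨ triMat-⊗ p a b s d d (+ 1) (- + 1) ⟩
  triMat (p +ℤ d) (d +ℤ p *ℤ + 1 +ℤ a *ℤ - + 1) (+ 1 +ℤ b *ℤ - + 1) (s *ℤ - + 1)
    ≈⟨ triMat-cong refl a-entry b-entry s-entry ⟩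
  triMat (p +ℤ d) ((p +ℤ d) -ℤ a) (+ 1 -ℤ b) (- s) ∎
  where
  open ≈-Reasoning
  a-entry : d +ℤ p *ℤ + 1 +ℤ a *ℤ - + 1 ≡ (p +ℤ d) -ℤ a
  a-entry = solve (p ∷ a ∷ d ∷ [])
  b-entry : + 1 +ℤ b *ℤ - + 1 ≡ + 1 -ℤ b
  b-entry = solve (b ∷ [])
  s-entry : s *ℤ - + 1 ≡ - s
  s-entry = solve (s ∷ [])

parityBar-suc : ∀ n → + parityBar (suc n) ≡ + 1 -ℤ + parityBar n
parityBar-suc zero          = refl
parityBar-suc (suc zero)    = refl
parityBar-suc (suc (suc n)) = parityBar-suc n

mainTheorem3 : (λs : List ℕ) → IsPartition λs →
    (i j : Fin 3) →
    evalWord (M λs) i j ≡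
      mat (+ 1) (+ part λs 1) (- altSum λs)
          (+ 0) (+ 1) (- (+ parityBar (len λs)))
          (+ 0) (+ 0) (negOnePow (len λs)) i j
mainTheorem3 []       _ = λ _ _ → refl
mainTheorem3 (x ∷ xs) P = begin
  evalWord (M (x ∷ xs))
    ≡⟨ cong evalWord (M-cons P) ⟩
  evalWord (M xs ++ replicate d Y ++ X ∷ [])
    ≈⟨ evalWord-++ (M xs) (replicate d Y ++ X ∷ []) ⟩
  evalWord (M xs) ⊗ evalWord (replicate d Y ++ X ∷ [])
    ≈⟨ ⊗-cong (mainTheorem3 xs (IsPartition-tail P)) (evalWord-Yᵈ-X d) ⟩
  triMat (+ λ₂) (altSum xs) (+ parityBar n) (negOnePow n) ⊗ triMat (+ d) (+ d) (+ 1) (- + 1)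
    ≈⟨ triMat-⊗-Yᵈ-X (+ λ₂) (altSum xs) (+ parityBar n) (negOnePow n) (+ d) ⟩
  triMat (+ λ₂ +ℤ + d) ((+ λ₂ +ℤ + d) -ℤ altSum xs) (+ 1 -ℤ + parityBar n) (- negOnePow n)
    ≈⟨ triMat-cong λ₂+d≡x (trans (cong (_-ℤ altSum xs) λ₂+d≡x) (sym (altSum-cons x xs)))
                   (sym (parityBar-suc n)) refl ⟩
  triMat (+ x) (altSum (x ∷ xs)) (+ parityBar (suc n)) (negOnePow (suc n)) ∎
  where
  open ≈-Reasoning
  n = len xs
  λ₂ = part xs 1
  d = x ∸ λ₂
  λ₂+d≡x : + λ₂ +ℤ + d ≡ + x
  λ₂+d≡x = cong +_ (m+[n∸m]≡n (IsPartition-λ₂≤λ₁ P))
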